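{- For finite groups $G,H$ we have $\delta(G\times H)\ge \delta(G)\delta(H)$, where $\delta(K)=\sum_{g\in K}\frac{1}{\mathrm{ord}(g)}$. Moreover, if $\gcd(|G|,|H|)=1$, then $\delta(G\times H)=\delta(G)\delta(H)$.
   Context: $\mathrm{ord}(g)$ denotes the order of a group element $g$. -}

module Defs where

open import Level using (Level; _⊔_) renaming (suc to lsuc)
open import Algebra.Bundles using (Group)
open import Data.Nat using (ℕ; zero; suc; _<_; _≤_)
open import Data.Product using (_×_)
open import Data.List using (List; length; foldr; map)
open import Data.Integer using (+_)
open import Data.Rational using (ℚ; 0ℚ; _+_; _/_)
import Data.List.Relation.Unary.Enumerates.Setoid as Enum
import Data.List.Relation.Unary.Unique.Setoid as Uniq

record FiniteGroup (c ℓ : Level) : Set (lsuc (c ⊔ ℓ)) where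
  field
    group    : Group c ℓ
  open Group group public
  field
    elements : List Carrier
    complete : Enum.IsEnumeration setoid elements
    unique   : Uniq.Unique setoid elements

card : ∀ {c ℓ} → FiniteGroup c ℓ → ℕ
card G = length (FiniteGroup.elements G)

module _ {c ℓ} (G : Group c ℓ) where
  open Group G

  pow : Carrier → ℕ → Carrier
  pow g zero    = ε
  pow g (suc k) = g ∙ pow g k

  IsOrder : Carrier → ℕ → Set ℓ
  IsOrder g k = (0 < k) × (pow g k ≈ ε) × (∀ m → 0 < m → pow g m ≈ ε → k ≤ m)

-- 1/k as a rational (k = 0 never occurs for an order; then 0 by convention)
recip : ℕ → ℚ
recip zero    = 0ℚ
recip (suc k) = (+ 1) / suc k

δ : ∀ {a} {A : Set a} → (A → ℕ) → List A → ℚ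
δ ord xs = foldr _+_ 0ℚ (map (λ x → recip (ord x)) xs)

module Submission where

-- Since the enumeration of G × H is the cartesian product of the
-- enumerations of G and H, δ(G) δ(H) = Σ_{(a,b)} 1/(ord a · ord b)
-- (sum-product), so it suffices to compare the summands.  The key fact is
-- ord(a, b) = lcm(ord a, ord b) (order-pair≡lcm), which is ≤ ord a · ord b,
-- giving 1/(ord a · ord b) ≤ 1/ord(a, b).  If |G| and |H| are coprime then,
-- by Lagrange's theorem for element orders (order∣card), so are ord a and
-- ord b, and the lcm is the product, giving equality summand by summand.
--
-- Lagrange's theorem is proved by orbit counting: left multiplication by g,
-- transported to the index set Fin |G| of the enumeration, is a permutation
-- all of whose orbits have exactly ord(g) elements, and any duplicate-free
-- list closed under such a permutation has length divisible by ord(g).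

open import Function.Base using (_∘_; id)
open import Function.Bundles using (mk⇔)
open import Algebra.Bundles using (Group)
open import Algebra.Construct.DirectProduct using (group)
open import Data.Empty using (⊥-elim)
open import Data.Product using (_×_; _,_; proj₁; proj₂)
open import Data.Fin using (Fin; zero; suc)
import Data.Fin.Properties as Fin
open import Data.Nat as ℕ using (ℕ; zero; suc; z≤n; s≤s)
import Data.Nat.Properties as ℕP
open import Data.Nat.GeneralisedArithmetic using (fold; fold-+)
open import Data.Nat.Divisibility using (_∣_; divides; _∣0; ∣-refl; ∣-trans; ∣-antisym; ∣⇒≤; m∣m*n; n∣m*n; ∣m∣n⇒∣m+n; m%n≡0⇒n∣m)
open import Data.Nat.DivMod using (m≡m%n+[m/n]*n; m%n<n)
open import Data.Nat.GCD using (gcd)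
open import Data.Nat.LCM using (lcm; m∣lcm[m,n]; n∣lcm[m,n]; lcm-least; gcd*lcm)
open import Data.Nat.Coprimality using (Coprime; coprime⇒gcd≡1)
import Data.Integer as ℤ
open import Data.Rational using (ℚ; 0ℚ; _+_; _*_; _≤_; toℚᵘ)
import Data.Rational.Properties as ℚP
import Data.Rational.Unnormalised as ℚᵘ
import Data.Rational.Unnormalised.Properties as ℚᵘP
open import Data.List using (List; []; _∷_; length; map; foldr; _++_; filter; lookup; applyUpTo; allFin; cartesianProduct)
open import Data.List.Properties using (length-applyUpTo; length-tabulate)
open import Data.List.Relation.Unary.Any using (here; index)
open import Data.List.Relation.Unary.Any.Properties using (lookup-index)
import Data.List.Relation.Unary.All as All
open import Data.List.Relation.Unary.AllPairs using (_∷_)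
open import Data.List.Membership.Propositional using (_∈_)
open import Data.List.Membership.Propositional.Properties using (∈-filter⁺; ∈-filter⁻; ∈-applyUpTo⁺; ∈-applyUpTo⁻; ∈-allFin; ∈-lookup)
open import Data.List.Membership.Propositional.Properties.WithK using (unique∧set⇒bag)
open import Data.List.Relation.Unary.Unique.Propositional using (Unique)
open import Data.List.Relation.Unary.Unique.Propositional.Properties using (applyUpTo⁺₁; filter⁺; allFin⁺)
import Data.List.Relation.Unary.Unique.Setoid as UniqueSetoid
open import Data.List.Relation.Binary.BagAndSetEquality using (∼bag⇒↭)
open import Data.List.Relation.Binary.Permutation.Propositional.Properties using (↭-length)
open import Relation.Binary.Bundles using (Setoid)
open import Relation.Binary.Definitions using (DecidableEquality)
open import Relation.Binary.PropositionalEquality as ≡ using (_≡_; _≢_; refl; cong; cong₂; subst; module ≡-Reasoning)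
open import Relation.Unary using (Pred; Decidable; ∁)
open import Relation.Unary.Properties using (∁?)
open import Relation.Nullary.Decidable using (yes; no)
open import Defs

sumℚ : ∀ {a} {A : Set a} → (A → ℚ) → List A → ℚ
sumℚ f xs = foldr _+_ 0ℚ (map f xs)

module _ {a} {A : Set a} where

  sum-++ : (f : A → ℚ) (xs ys : List A) → sumℚ f (xs ++ ys) ≡ sumℚ f xs + sumℚ f ys
  sum-++ f []       ys = ≡.sym (ℚP.+-identityˡ _)
  sum-++ f (x ∷ xs) ys = ≡.trans (cong (f x +_) (sum-++ f xs ys)) (≡.sym (ℚP.+-assoc (f x) _ _))

  sum-*ˡ : (c : ℚ) (f : A → ℚ) (xs : List A) → c * sumℚ f xs ≡ sumℚ (λ x → c * f x) xs
  sum-*ˡ c f []       = ℚP.*-zeroʳ c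
  sum-*ˡ c f (x ∷ xs) = ≡.trans (ℚP.*-distribˡ-+ c (f x) _) (cong (c * f x +_) (sum-*ˡ c f xs))

  sum-mono : (f g : A → ℚ) → (∀ x → f x ≤ g x) → (xs : List A) → sumℚ f xs ≤ sumℚ g xs
  sum-mono f g f≤g []       = ℚP.≤-refl
  sum-mono f g f≤g (x ∷ xs) = ℚP.+-mono-≤ (f≤g x) (sum-mono f g f≤g xs)

  sum-cong : (f g : A → ℚ) → (∀ x → f x ≡ g x) → (xs : List A) → sumℚ f xs ≡ sumℚ g xs
  sum-cong f g f≡g []       = refl
  sum-cong f g f≡g (x ∷ xs) = cong₂ _+_ (f≡g x) (sum-cong f g f≡g xs)

sum-map : ∀ {a b} {A : Set a} {B : Set b} (f : B → ℚ) (h : A → B) (xs : List A) →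
          sumℚ f (map h xs) ≡ sumℚ (f ∘ h) xs
sum-map f h []       = refl
sum-map f h (x ∷ xs) = cong (f (h x) +_) (sum-map f h xs)

sum-product : ∀ {a b} {A : Set a} {B : Set b} (f : A → ℚ) (g : B → ℚ) (xs : List A) (ys : List B) →
              sumℚ f xs * sumℚ g ys ≡ sumℚ (λ z → f (proj₁ z) * g (proj₂ z)) (cartesianProduct xs ys)
sum-product f g []       ys = ℚP.*-zeroˡ (sumℚ g ys)
sum-product {A = A} {B = B} f g (x ∷ xs) ys = begin
  (f x + sumℚ f xs) * sumℚ g ys
    ≡⟨ ℚP.*-distribʳ-+ (sumℚ g ys) (f x) (sumℚ f xs) ⟩
  f x * sumℚ g ys + sumℚ f xs * sumℚ g ys
    ≡⟨ cong₂ _+_ (≡.trans (sum-*ˡ (f x) g ys) (≡.sym (sum-map h (x ,_) ys))) (sum-product f g xs ys) ⟩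
  sumℚ h (map (x ,_) ys) + sumℚ h (cartesianProduct xs ys)
    ≡⟨ ≡.sym (sum-++ h (map (x ,_) ys) _) ⟩
  sumℚ h (cartesianProduct (x ∷ xs) ys) ∎
  where
  open ≡-Reasoning
  h : A × B → ℚ
  h = λ z → f (proj₁ z) * g (proj₂ z)

recip-unnormalised : ∀ k → toℚᵘ (recip (suc k)) ℚᵘ.≃ ℚᵘ.mkℚᵘ (ℤ.+ 1) k
recip-unnormalised k = ℚP.toℚᵘ-fromℚᵘ (ℚᵘ.mkℚᵘ (ℤ.+ 1) k)

recip-* : ∀ m n → recip (m ℕ.* n) ≡ recip m * recip n
recip-* zero    n       = ≡.sym (ℚP.*-zeroˡ (recip n))
recip-* (suc m) zero    rewrite ℕP.*-zeroʳ m = ≡.sym (ℚP.*-zeroʳ (recip (suc m)))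
recip-* (suc m) (suc n) = ℚP.toℚᵘ-injective (begin
  toℚᵘ (recip (suc m ℕ.* suc n))   ≈⟨ recip-unnormalised (n ℕ.+ m ℕ.* suc n) ⟩
  ℚᵘ.mkℚᵘ (ℤ.+ 1) m ℚᵘ.* ℚᵘ.mkℚᵘ (ℤ.+ 1) n
    ≈⟨ ℚᵘP.*-cong (ℚᵘP.≃-sym (recip-unnormalised m)) (ℚᵘP.≃-sym (recip-unnormalised n)) ⟩
  toℚᵘ (recip (suc m)) ℚᵘ.* toℚᵘ (recip (suc n))
    ≈⟨ ℚᵘP.≃-sym (ℚP.toℚᵘ-homo-* (recip (suc m)) (recip (suc n))) ⟩
  toℚᵘ (recip (suc m) * recip (suc n)) ∎)
  where open ℚᵘP.≃-Reasoning

recip-antitone : ∀ {m n} → 0 ℕ.< m → m ℕ.≤ n → recip n ≤ recip m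
recip-antitone {suc m} {suc n} _ m≤n = ℚP.toℚᵘ-cancel-≤
  (ℚᵘP.≤-respˡ-≃ (ℚᵘP.≃-sym (recip-unnormalised n))
    (ℚᵘP.≤-respʳ-≃ (ℚᵘP.≃-sym (recip-unnormalised m))
      (ℚᵘ.*≤* (ℤ.+≤+ (ℕP.*-monoʳ-≤ 1 m≤n)))))

lcm≤* : ∀ m n → .{{_ : ℕ.NonZero m}} → .{{_ : ℕ.NonZero n}} → lcm m n ℕ.≤ m ℕ.* n
lcm≤* m n = ∣⇒≤ {{ℕP.m*n≢0 m n}} (lcm-least {m} {n} (m∣m*n n) (n∣m*n m))

coprime⇒lcm≡* : ∀ {m n} → Coprime m n → lcm m n ≡ m ℕ.* n
coprime⇒lcm≡* {m} {n} coprime = begin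
  lcm m n             ≡⟨ ≡.sym (ℕP.*-identityˡ (lcm m n)) ⟩
  1 ℕ.* lcm m n       ≡⟨ cong (ℕ._* lcm m n) (≡.sym (coprime⇒gcd≡1 coprime)) ⟩
  gcd m n ℕ.* lcm m n ≡⟨ gcd*lcm m n ⟩
  m ℕ.* n             ∎
  where open ≡-Reasoning

coprime-∣ : ∀ {m n p q} → Coprime m n → p ∣ m → q ∣ n → Coprime p q
coprime-∣ coprime p∣m q∣n (d∣p , d∣q) = coprime (∣-trans d∣p p∣m , ∣-trans d∣q q∣n)

length-filter-∁ : ∀ {a p} {A : Set a} {P : Pred A p} (P? : Decidable P) (xs : List A) →
                  length xs ≡ length (filter P? xs) ℕ.+ length (filter (∁? P?) xs)
length-filter-∁ P? []       = refl
length-filter-∁ P? (x ∷ xs) with P? x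
... | yes _ = cong suc (length-filter-∁ P? xs)
... | no  _ = ≡.trans (cong suc (length-filter-∁ P? xs)) (≡.sym (ℕP.+-suc _ _))

lookup-injective : ∀ {c ℓ} (S : Setoid c ℓ) (xs : List (Setoid.Carrier S)) → UniqueSetoid.Unique S xs →
                   ∀ i j → Setoid._≈_ S (lookup xs i) (lookup xs j) → i ≡ j
lookup-injective S (x ∷ xs) (_   ∷ u) zero    zero    _ = refl
lookup-injective S (x ∷ xs) (x∉ ∷ u) zero    (suc j) e = ⊥-elim (All.lookup x∉ (∈-lookup j) e)
lookup-injective S (x ∷ xs) (x∉ ∷ u) (suc i) zero    e = ⊥-elim (All.lookup x∉ (∈-lookup i) (Setoid.sym S e))
lookup-injective S (x ∷ xs) (_   ∷ u) (suc i) (suc j) e = cong suc (lookup-injective S xs u i j e)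

-- Let σ be a map on a set with decidable equality such
-- that every point has exact period n = 1 + n₀ (σⁿ x = x and σᵏ x ≠ x for
-- 0 < k < n; σᵏ x is written fold x σ k).  Then every duplicate-free list
-- closed under σ is a disjoint union of orbits of size n, so n divides
-- its length.

module OrbitCounting {a} {A : Set a} (_≟_ : DecidableEquality A) (σ : A → A) (n₀ : ℕ)
    (periodic : ∀ x → fold x σ (suc n₀) ≡ x)
    (aperiodic : ∀ x k → 0 ℕ.< k → k ℕ.< suc n₀ → fold x σ k ≢ x) where

  open import Data.List.Membership.DecPropositional _≟_ using (_∈?_)

  n : ℕ
  n = suc n₀

  fold-suc : ∀ x k → fold x σ (suc k) ≡ fold (σ x) σ k
  fold-suc x zero    = refl
  fold-suc x (suc k) = cong σ (fold-suc x k)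

  -- σ is a permutation; its inverse is σ^n₀
  σ-injective : ∀ {x y} → σ x ≡ σ y → x ≡ y
  σ-injective {x} {y} σx≡σy = begin
    x                 ≡⟨ ≡.sym (periodic x) ⟩
    fold x σ n        ≡⟨ fold-suc x n₀ ⟩
    fold (σ x) σ n₀   ≡⟨ cong (λ z → fold z σ n₀) σx≡σy ⟩
    fold (σ y) σ n₀   ≡⟨ ≡.sym (fold-suc y n₀) ⟩
    fold y σ n        ≡⟨ periodic y ⟩
    y                 ∎
    where open ≡-Reasoning

  orbit : A → List A
  orbit x = applyUpTo (fold x σ) n

  orbit-unique : ∀ x → Unique (orbit x)
  orbit-unique x = applyUpTo⁺₁ (fold x σ) n distinct
    where
    -- σʲ x = σⁱ x with i < j < n would make σ^(j-i) fix σⁱ x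
    distinct : ∀ {i j} → i ℕ.< j → j ℕ.< n → fold x σ i ≢ fold x σ j
    distinct {i} {j} i<j j<n σⁱx≡σʲx =
      aperiodic (fold x σ i) (j ℕ.∸ i) (ℕP.m<n⇒0<n∸m i<j) (ℕP.≤-<-trans (ℕP.m∸n≤m j i) j<n) (begin
        fold (fold x σ i) σ (j ℕ.∸ i) ≡⟨ ≡.sym (fold-+ x σ (j ℕ.∸ i)) ⟩
        fold x σ (j ℕ.∸ i ℕ.+ i)      ≡⟨ cong (fold x σ) (ℕP.m∸n+n≡m (ℕP.<⇒≤ i<j)) ⟩
        fold x σ j                    ≡⟨ ≡.sym σⁱx≡σʲx ⟩
        fold x σ i                    ∎)
      where open ≡-Reasoning

  orbit-preimage : ∀ x {y} → σ y ∈ orbit x → y ∈ orbit x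
  orbit-preimage x {y} σy∈ with ∈-applyUpTo⁻ (fold x σ) σy∈
  ... | zero  , _   , σy≡x  =
    subst (_∈ orbit x) (σ-injective (≡.trans (periodic x) (≡.sym σy≡x))) (∈-applyUpTo⁺ (fold x σ) (ℕP.n<1+n n₀))
  ... | suc i , i<n , σy≡σⁱ⁺¹x =
    subst (_∈ orbit x) (σ-injective (≡.sym σy≡σⁱ⁺¹x)) (∈-applyUpTo⁺ (fold x σ) (ℕP.<-trans (ℕP.n<1+n i) i<n))

  Closed : List A → Set a
  Closed L = ∀ {y} → y ∈ L → σ y ∈ L

  orbit-⊆ : ∀ {L x} → Closed L → x ∈ L → ∀ {y} → y ∈ orbit x → y ∈ L
  orbit-⊆ {L} {x} closed x∈L y∈ with ∈-applyUpTo⁻ (fold x σ) y∈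
  ... | i , _ , refl = iterate i
    where
    iterate : ∀ k → fold x σ k ∈ L
    iterate zero    = x∈L
    iterate (suc k) = closed (iterate k)

  orbit-count : ∀ {L x} → Unique L → Closed L → x ∈ L → length (filter (_∈? orbit x) L) ≡ n
  orbit-count {L} {x} unique closed x∈L = ≡.trans
    (↭-length (∼bag⇒↭ (unique∧set⇒bag (filter⁺ (_∈? orbit x) unique) (orbit-unique x)
      (mk⇔ (proj₂ ∘ ∈-filter⁻ (_∈? orbit x) {xs = L}) (λ y∈ → ∈-filter⁺ (_∈? orbit x) {xs = L} (orbit-⊆ closed x∈L y∈) y∈)))))
    (length-applyUpTo (fold x σ) n)

  -- strong induction on the length (bounded by the fuel argument):
  -- remove the orbit of the head, the rest is again closed
  private
    divisible : ∀ fuel (L : List A) → length L ℕ.≤ fuel → Unique L → Closed L → n ∣ length L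
    divisible _          []      _    _      _      = n ∣0
    divisible (suc fuel) (x ∷ L) len≤ unique closed =
      subst (n ∣_) (≡.sym split) (∣m∣n⇒∣m+n ∣-refl (divisible fuel rest shorter (filter⁺ outside? unique) rest-closed))
      where
      outside? : Decidable (∁ (_∈ orbit x))
      outside? = ∁? (_∈? orbit x)
      rest : List A
      rest = filter outside? (x ∷ L)
      split : length (x ∷ L) ≡ n ℕ.+ length rest
      split = ≡.trans (length-filter-∁ (_∈? orbit x) (x ∷ L)) (cong (ℕ._+ length rest) (orbit-count unique closed (here refl)))
      shorter : length rest ℕ.≤ fuel
      shorter = ℕP.≤-trans (ℕP.m≤n+m (length rest) n₀) (ℕP.≤-pred (subst (ℕ._≤ suc fuel) split len≤))
      rest-closed : Closed rest
      rest-closed y∈ with ∈-filter⁻ outside? y∈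
      ... | y∈L , y∉orbit = ∈-filter⁺ outside? (closed y∈L) (y∉orbit ∘ orbit-preimage x)

  closed-divisible : ∀ L → Unique L → Closed L → n ∣ length L
  closed-divisible L = divisible (length L) L ℕP.≤-refl

module Powers {c ℓ} (G : Group c ℓ) where
  open Group G renaming (refl to ≈-refl)
  open import Relation.Binary.Reasoning.Setoid setoid

  pow-+ : ∀ g m n → pow G g (m ℕ.+ n) ≈ pow G g m ∙ pow G g n
  pow-+ g zero    n = sym (identityˡ _)
  pow-+ g (suc m) n = trans (∙-congˡ (pow-+ g m n)) (sym (assoc _ _ _))

  pow-∣ : ∀ g {k m} → pow G g k ≈ ε → k ∣ m → pow G g m ≈ ε
  pow-∣ g {k} gᵏ≈ε (divides q refl) = multiple q
    where
    multiple : ∀ q → pow G g (q ℕ.* k) ≈ ε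
    multiple zero    = ≈-refl
    multiple (suc q) = trans (pow-+ g k (q ℕ.* k)) (trans (∙-cong gᵏ≈ε (multiple q)) (identityˡ ε))

  below-order : ∀ {g k} → IsOrder G g k → ∀ r → r ℕ.< k → pow G g r ≈ ε → r ≡ 0
  below-order _                 zero    _   _    = refl
  below-order (_ , _ , minimal) (suc r) r<k gʳ≈ε = ⊥-elim (ℕP.<⇒≱ r<k (minimal (suc r) (s≤s z≤n) gʳ≈ε))

  -- the order divides every exponent m with g^m = ε (divide m by the order;
  -- the remainder r satisfies g^r = ε, so it vanishes)
  order-∣ : ∀ {g k} m → IsOrder G g k → pow G g m ≈ ε → k ∣ m
  order-∣ {g} {suc k} m ord@(_ , gᵏ≈ε , _) gᵐ≈ε =
    m%n≡0⇒n∣m m (suc k) (below-order ord r (m%n<n m (suc k)) gʳ≈ε)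
    where
    r q : ℕ
    r = m ℕ.% suc k
    q = m ℕ./ suc k
    gʳ≈ε : pow G g r ≈ ε
    gʳ≈ε = begin
      pow G g r                           ≈⟨ sym (identityʳ _) ⟩
      pow G g r ∙ ε                       ≈⟨ ∙-congˡ (sym (pow-∣ g gᵏ≈ε (n∣m*n q))) ⟩
      pow G g r ∙ pow G g (q ℕ.* suc k)   ≈⟨ sym (pow-+ g r _) ⟩
      pow G g (r ℕ.+ q ℕ.* suc k)         ≡⟨ cong (pow G g) (≡.sym (m≡m%n+[m/n]*n m (suc k))) ⟩
      pow G g m                           ≈⟨ gᵐ≈ε ⟩
      ε                                   ∎

-- Left
-- multiplication by g, read on the positions of the enumeration, is a map
-- on Fin |G| all of whose points have exact period ord(g).

module Lagrange {c ℓ} (G : FiniteGroup c ℓ) where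
  open FiniteGroup G renaming (group to Gᵍ)
  open Powers Gᵍ using (pow-+)
  open import Algebra.Properties.Group Gᵍ using (identityˡ-unique)
  open import Relation.Binary.Reasoning.Setoid setoid

  element : Fin (card G) → Carrier
  element = lookup elements

  position : Carrier → Fin (card G)
  position x = index (complete x)

  element-position : ∀ x → element (position x) ≈ x
  element-position x = sym (lookup-index (complete x))

  module _ (g : Carrier) (n₀ : ℕ) (ord : IsOrder Gᵍ g (suc n₀)) where

    shift : Fin (card G) → Fin (card G)
    shift i = position (g ∙ element i)

    element-shiftᵏ : ∀ i k → element (fold i shift k) ≈ pow Gᵍ g k ∙ element i
    element-shiftᵏ i zero    = sym (identityˡ _)
    element-shiftᵏ i (suc k) = begin
      element (shift (fold i shift k))    ≈⟨ element-position _ ⟩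
      g ∙ element (fold i shift k)        ≈⟨ ∙-congˡ (element-shiftᵏ i k) ⟩
      g ∙ (pow Gᵍ g k ∙ element i)        ≈⟨ sym (assoc _ _ _) ⟩
      pow Gᵍ g (suc k) ∙ element i        ∎

    shift-periodic : ∀ i → fold i shift (suc n₀) ≡ i
    shift-periodic i = lookup-injective setoid elements unique _ _ (begin
      element (fold i shift (suc n₀))  ≈⟨ element-shiftᵏ i (suc n₀) ⟩
      pow Gᵍ g (suc n₀) ∙ element i    ≈⟨ ∙-congʳ (proj₁ (proj₂ ord)) ⟩
      ε ∙ element i                    ≈⟨ identityˡ _ ⟩
      element i                        ∎)

    shift-aperiodic : ∀ i k → 0 ℕ.< k → k ℕ.< suc n₀ → fold i shift k ≢ i
    shift-aperiodic i k 0<k k<n shiftᵏi≡i = ℕP.<⇒≱ k<n (proj₂ (proj₂ ord) k 0<k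
      (identityˡ-unique _ _ (trans (sym (element-shiftᵏ i k)) (reflexive (cong element shiftᵏi≡i)))))

  order∣card : ∀ {g k} → IsOrder Gᵍ g k → k ∣ card G
  order∣card {g} {suc n₀} ord = subst (suc n₀ ∣_) (length-tabulate id)
    (closed-divisible (allFin (card G)) (allFin⁺ (card G)) (λ _ → ∈-allFin _))
    where open OrbitCounting Fin._≟_ (shift g n₀ ord) n₀ (shift-periodic g n₀ ord) (shift-aperiodic g n₀ ord)

module DirectProduct {c₁ ℓ₁ c₂ ℓ₂} (G : Group c₁ ℓ₁) (H : Group c₂ ℓ₂) where
  private
    module G = Group G
    module H = Group H
    module G×H = Group (group G H)

  pow-pair : ∀ a b k → pow (group G H) (a , b) k ≡ (pow G a k , pow H b k)
  pow-pair a b zero    = refl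
  pow-pair a b (suc k) rewrite pow-pair a b k = refl

  pow-pair-trivial : ∀ a b k → pow G a k G.≈ G.ε → pow H b k H.≈ H.ε → pow (group G H) (a , b) k G×H.≈ G×H.ε
  pow-pair-trivial a b k aᵏ≈ε bᵏ≈ε rewrite pow-pair a b k = aᵏ≈ε , bᵏ≈ε

  pow-pair-components : ∀ a b k → pow (group G H) (a , b) k G×H.≈ G×H.ε → (pow G a k G.≈ G.ε) × (pow H b k H.≈ H.ε)
  pow-pair-components a b k rewrite pow-pair a b k = id

  order-pair≡lcm : ∀ {a b p q r} → IsOrder G a p → IsOrder H b q → IsOrder (group G H) (a , b) r → r ≡ lcm p q
  order-pair≡lcm {a} {b} {p} {q} {r} ordA ordB ordAB = ∣-antisym r∣lcm lcm∣r
    where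
    r∣lcm : r ∣ lcm p q
    r∣lcm = Powers.order-∣ (group G H) (lcm p q) ordAB (pow-pair-trivial a b (lcm p q)
      (Powers.pow-∣ G a (proj₁ (proj₂ ordA)) (m∣lcm[m,n] p q))
      (Powers.pow-∣ H b (proj₁ (proj₂ ordB)) (n∣lcm[m,n] p q)))
    components : (pow G a r G.≈ G.ε) × (pow H b r H.≈ H.ε)
    components = pow-pair-components a b r (proj₁ (proj₂ ordAB))
    lcm∣r : lcm p q ∣ r
    lcm∣r = lcm-least (Powers.order-∣ G r ordA (proj₁ components)) (Powers.order-∣ H r ordB (proj₂ components))

module Summands {c₁ ℓ₁ c₂ ℓ₂} (G : FiniteGroup c₁ ℓ₁) (H : FiniteGroup c₂ ℓ₂) where
  private
    Gᵍ : Group c₁ ℓ₁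
    Gᵍ = FiniteGroup.group G
    Hᵍ : Group c₂ ℓ₂
    Hᵍ = FiniteGroup.group H
  open DirectProduct Gᵍ Hᵍ using (order-pair≡lcm)

  -- ord(a, b) = lcm(ord a, ord b) ≤ ord a · ord b
  summand-≤ : ∀ {a b p q r} → IsOrder Gᵍ a p → IsOrder Hᵍ b q → IsOrder (group Gᵍ Hᵍ) (a , b) r →
              recip p * recip q ≤ recip r
  summand-≤ {p = p@(suc _)} {q@(suc _)} {r} ordA ordB ordAB@(0<r , _) = subst (_≤ recip r) (recip-* p q)
    (recip-antitone 0<r (subst (ℕ._≤ p ℕ.* q) (≡.sym (order-pair≡lcm ordA ordB ordAB)) (lcm≤* p q)))

  -- for coprime |G|, |H| the orders of a and b are coprime (Lagrange), so
  -- ord(a, b) = ord a · ord b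
  summand-≡ : Coprime (card G) (card H) → ∀ {a b p q r} → IsOrder Gᵍ a p → IsOrder Hᵍ b q →
              IsOrder (group Gᵍ Hᵍ) (a , b) r → recip r ≡ recip p * recip q
  summand-≡ coprime {p = p} {q} {r} ordA ordB ordAB = begin
    recip r           ≡⟨ cong recip (order-pair≡lcm ordA ordB ordAB) ⟩
    recip (lcm p q)   ≡⟨ cong recip (coprime⇒lcm≡* (coprime-∣ coprime (Lagrange.order∣card G ordA) (Lagrange.order∣card H ordB))) ⟩
    recip (p ℕ.* q)   ≡⟨ recip-* p q ⟩
    recip p * recip q ∎
    where open ≡-Reasoning

open FiniteGroup using (Carrier; elements)

proposition7p15 : ∀ {c₁ ℓ₁ c₂ ℓ₂} (G : FiniteGroup c₁ ℓ₁) (H : FiniteGroup c₂ ℓ₂)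
    (ordG : Carrier G → ℕ) (ordH : Carrier H → ℕ) (ordGH : Carrier G × Carrier H → ℕ)
    → (∀ g → IsOrder (FiniteGroup.group G) g (ordG g))
    → (∀ h → IsOrder (FiniteGroup.group H) h (ordH h))
    → (∀ x → IsOrder (group (FiniteGroup.group G) (FiniteGroup.group H)) x (ordGH x))
    → (δ ordG (elements G) * δ ordH (elements H) ≤ δ ordGH (cartesianProduct (elements G) (elements H)))
      × (Coprime (card G) (card H) → δ ordGH (cartesianProduct (elements G) (elements H)) ≡ δ ordG (elements G) * δ ordH (elements H))
proposition7p15 G H ordG ordH ordGH isOrdG isOrdH isOrdGH = lower-bound , coprime-equality
  where
  open Summands G H
  xs : List (Carrier G)
  xs = elements G
  ys : List (Carrier H)
  ys = elements H
  product-summand : Carrier G × Carrier H → ℚ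
  product-summand (a , b) = recip (ordG a) * recip (ordH b)
  δG·δH : δ ordG xs * δ ordH ys ≡ sumℚ product-summand (cartesianProduct xs ys)
  δG·δH = sum-product (recip ∘ ordG) (recip ∘ ordH) xs ys

  lower-bound : δ ordG xs * δ ordH ys ≤ δ ordGH (cartesianProduct xs ys)
  lower-bound = subst (_≤ δ ordGH (cartesianProduct xs ys)) (≡.sym δG·δH) (sum-mono product-summand (recip ∘ ordGH)
    (λ (a , b) → summand-≤ (isOrdG a) (isOrdH b) (isOrdGH (a , b))) (cartesianProduct xs ys))

  coprime-equality : Coprime (card G) (card H) → δ ordGH (cartesianProduct xs ys) ≡ δ ordG xs * δ ordH ys
  coprime-equality coprime = ≡.trans (sum-cong (recip ∘ ordGH) product-summand
    (λ (a , b) → summand-≡ coprime (isOrdG a) (isOrdH b) (isOrdGH (a , b))) (cartesianProduct xs ys)) (≡.sym δG·δH)
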